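{- In the setting described in the context, if $q$ is $k$-admissible, then the $k$-free part of any positive integer $n$ satisfying $\gcd(f(n),q)=1$ is bounded by a constant depending only on the polynomials $\{W_{i,v}\}_{1\le i\le K,\,1\le v\le k}$.
   Context: Setting: Fix integers $K,V\ge1$. Let $f_1,\dots,f_K:\mathbb N\to\mathbb Z$ be multiplicative and $W_{i,v}\in\mathbb Z[T]$ ($i\le K$, $v\le V$) with $f_i(p^v)=W_{i,v}(p)$ for all primes $p$. Put $f=\prod_if_i$, $W_v=\prod_iW_{i,v}$, $U_q=(\mathbb Z/q\mathbb Z)^\times$, $R_v(q)=\{u\in U_q:\gcd(W_v(u),q)=1\}$. Fix $k\le V$ with $W_{1,k},\dots,W_{K,k}$ nonconstant and multiplicatively independent. $q$ is $k$-admissible if $R_k(q)\ne\emptyset$ and $R_v(q)=\emptyset$ for all $v<k$. The $k$-free part of $n$ is $\prod_{p:\,v_p(n)<k}p^{v_p(n)}$, i.e. $B$ in the unique factorization $n=AB$ with $\gcd(A,B)=1$, $A$ $k$-full and $B$ $k$-free. -}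

module Defs where

open import Data.Nat using (ℕ; zero; suc; _≤_; _<_)
import Data.Nat
open import Data.Nat.Coprimality using (Coprime)
open import Data.Nat.Primality using (Prime)
open import Data.Nat.Divisibility using (_∣_)
open import Data.Integer as ℤ using (ℤ; +_; ∣_∣; 0ℤ; 1ℤ)
open import Data.Fin using (Fin) renaming (zero to fzero; suc to fsuc)
open import Data.List using (List; []; _∷_)
open import Data.Product using (Σ; _×_; ∃)
open import Relation.Nullary using (¬_)
open import Relation.Binary.PropositionalEquality using (_≡_; _≢_)

-- Integer polynomials as coefficient lists, constant term first.
Poly : Set
Poly = List ℤ

eval : Poly → ℤ → ℤ
eval []       x = 0ℤ
eval (c ∷ cs) x = c ℤ.+ x ℤ.* eval cs x

coeff : Poly → ℕ → ℤ
coeff []       j       = 0ℤ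
coeff (c ∷ cs) zero    = c
coeff (c ∷ cs) (suc j) = coeff cs j

Nonconstant : Poly → Set
Nonconstant P = Σ ℕ λ j → (1 ≤ j) × (coeff P j ≢ 0ℤ)

prodFin : (K : ℕ) → (Fin K → ℤ) → ℤ
prodFin zero    g = 1ℤ
prodFin (suc K) g = g fzero ℤ.* prodFin K (λ i → g (fsuc i))

monoVal : (K : ℕ) → (Fin K → Poly) → (Fin K → ℕ) → ℤ → ℤ
monoVal K P e x = prodFin K (λ i → eval (P i) x ℤ.^ e i)

-- P_1..P_K multiplicatively independent: no exponent vector (e_i) ∈ ℤ^K \ {0}
-- makes ∏ P_i^{e_i} a constant.  Writing e = a - b with a,b ∈ ℕ^K, this says:
-- there are no a ≠ b and nonzero constants c, d with
-- c · ∏ P_i^{a_i} = d · ∏ P_i^{b_i} (as polynomials, i.e. as functions on ℤ).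
MultIndependent : (K : ℕ) → (Fin K → Poly) → Set
MultIndependent K P =
  ¬ (Σ (Fin K → ℕ) λ a → Σ (Fin K → ℕ) λ b → Σ ℤ λ c → Σ ℤ λ d →
       (Σ (Fin K) λ i → a i ≢ b i) × (c ≢ 0ℤ) × (d ≢ 0ℤ) ×
       (∀ x → c ℤ.* monoVal K P a x ≡ d ℤ.* monoVal K P b x))

Multiplicative : (ℕ → ℤ) → Set
Multiplicative g = (g 1 ≡ 1ℤ) ×
  (∀ m n → 1 ≤ m → 1 ≤ n → Coprime m n → g (m Data.Nat.* n) ≡ g m ℤ.* g n)

Wv : (K : ℕ) → (Fin K → ℕ → Poly) → ℕ → ℤ → ℤ
Wv K W v x = prodFin K (λ i → eval (W i v) x)

-- R_v(q) ≠ ∅, with U_q represented by residues 0 ≤ u < q coprime to q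
RNonempty : (K : ℕ) → (Fin K → ℕ → Poly) → ℕ → ℕ → Set
RNonempty K W v q = Σ ℕ λ u → (u < q) × Coprime u q × Coprime ∣ Wv K W v (+ u) ∣ q

Admissible : (K : ℕ) → (Fin K → ℕ → Poly) → ℕ → ℕ → Set
Admissible K W k q = RNonempty K W k q × (∀ v → 1 ≤ v → v < k → ¬ RNonempty K W v q)

KFull : ℕ → ℕ → Set
KFull k A = ∀ p → Prime p → p ∣ A → (p Data.Nat.^ k) ∣ A

KFree : ℕ → ℕ → Set
KFree k B = ∀ p → Prime p → ¬ ((p Data.Nat.^ k) ∣ B)

IsKFreePart : ℕ → ℕ → ℕ → Set
IsKFreePart k n B = Σ ℕ λ A → (n ≡ A Data.Nat.* B) × Coprime A B × KFull k A × KFree k B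

{-# OPTIONS --safe #-}
-- Let N bound the degrees of the polynomials W_v (v ≤ k), and suppose a prime p > N divides the
-- k-free part B of n.  Then p^a ∥ n for some 1 ≤ a < k, and multiplicativity makes W_a(p) a factor
-- of f(n), so gcd(W_a(p), q) = 1.  If p ∤ q, then u = p lies in R_a(q).  Otherwise write q = p^b q'
-- with p ∤ q' and look at u = p + j q' for 1 ≤ j ≤ N: every such u is ≡ p (mod q'), and not all
-- W_a(u) are divisible by p, since the N-th finite difference of W_a(p + y q') vanishes and would
-- then force p ∣ W_a(p).  As j < p, such a u is prime to p too, so again R_a(q) ≠ ∅, contradicting
-- k-admissibility.  Hence B is k-free with all prime factors ≤ N, so B ∣ (N!)^(k-1).
module Submission where

open import Defs
open import Data.Nat using (ℕ; zero; suc; _≤_; _<_; _^_; z≤n; s≤s)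
import Data.Nat as ℕ
import Data.Nat.Properties as ℕ
open import Data.Nat.Coprimality using (Coprime)
open import Data.Nat.Primality using (Prime)
open import Data.Integer using (ℤ; +_; ∣_∣)
open import Data.Fin using (Fin; toℕ; fromℕ) renaming (zero to fzero; suc to fsuc)
open import Data.List using ([]; _∷_)
open import Data.Product using (Σ; _×_; _,_)
open import Function using (_∘_)
open import Relation.Binary.PropositionalEquality using (_≡_; refl; sym; trans; cong; subst)

sumFin : ∀ K → (Fin K → ℕ) → ℕ
sumFin zero    d = 0
sumFin (suc K) d = d fzero ℕ.+ sumFin K (λ i → d (fsuc i))

≤-sumFin : ∀ K (d : Fin K → ℕ) i → d i ≤ sumFin K d
≤-sumFin (suc K) d fzero    = ℕ.m≤m+n (d fzero) _
≤-sumFin (suc K) d (fsuc i) = ℕ.≤-trans (≤-sumFin K (λ i → d (fsuc i)) i) (ℕ.m≤n+m _ (d fzero))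

module FiniteDifference where
  open import Data.Integer using (0ℤ; 1ℤ; _+_; _*_; _-_)
  open import Data.Integer.Properties using (+-inverseʳ; *-zeroʳ)
  open import Data.Integer.Divisibility.Signed using (_∣_; _∣?_; divides; ∣m∣n⇒∣m-n)
  open import Data.Integer.Tactic.RingSolver using (solve-∀)
  open import Data.Fin using (inject₁)
  open import Data.Fin.Properties using (toℕ-inject₁; ¬∀⟶∃¬)
  open import Relation.Nullary using (¬_)
  open import Relation.Binary.PropositionalEquality using (cong₂; _≗_)

  Δ : (ℤ → ℤ) → ℤ → ℤ
  Δ F x = F (x + 1ℤ) - F x

  -- For a polynomial function F this says deg F < n.
  DegreeBelow : ℕ → (ℤ → ℤ) → Set
  DegreeBelow zero    F = ∀ x → F x ≡ 0ℤ
  DegreeBelow (suc n) F = DegreeBelow n (Δ F)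

  DegreeBelow-resp : ∀ n {F G} → F ≗ G → DegreeBelow n F → DegreeBelow n G
  DegreeBelow-resp zero    F≗G deg x = trans (sym (F≗G x)) (deg x)
  DegreeBelow-resp (suc n) F≗G deg =
    DegreeBelow-resp n (λ x → cong₂ _-_ (F≗G (x + 1ℤ)) (F≗G x)) deg

  DegreeBelow-suc : ∀ n F → DegreeBelow n F → DegreeBelow (suc n) F
  DegreeBelow-suc zero    F deg x = cong₂ _-_ (deg (x + 1ℤ)) (deg x)
  DegreeBelow-suc (suc n) F deg   = DegreeBelow-suc n (Δ F) deg

  DegreeBelow-mono : ∀ {m n} F → m ≤ n → DegreeBelow m F → DegreeBelow n F
  DegreeBelow-mono {n = zero}  F z≤n       deg = deg
  DegreeBelow-mono {n = suc n} F z≤n       deg = DegreeBelow-suc n F (DegreeBelow-mono {n = n} F z≤n deg)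
  DegreeBelow-mono             F (s≤s m≤n) deg = DegreeBelow-mono (Δ F) m≤n deg

  DegreeBelow-const : ∀ c → DegreeBelow 1 (λ _ → c)
  DegreeBelow-const c x = +-inverseʳ c

  DegreeBelow-+ : ∀ n F G → DegreeBelow n F → DegreeBelow n G → DegreeBelow n (λ x → F x + G x)
  DegreeBelow-+ zero    F G degF degG x = cong₂ _+_ (degF x) (degG x)
  DegreeBelow-+ (suc n) F G degF degG =
    DegreeBelow-resp n (λ x → sym (interchange (F (x + 1ℤ)) (F x) (G (x + 1ℤ)) (G x)))
      (DegreeBelow-+ n (Δ F) (Δ G) degF degG)
    where
    interchange : ∀ a b c d → (a + c) - (b + d) ≡ (a - b) + (c - d)
    interchange = solve-∀

  DegreeBelow-shift : ∀ n F s → DegreeBelow n F → DegreeBelow n (λ x → F (x + s))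
  DegreeBelow-shift zero    F s deg x = deg (x + s)
  DegreeBelow-shift (suc n) F s deg =
    DegreeBelow-resp n (λ x → cong (λ y → F y - F (x + s)) (swap x s))
      (DegreeBelow-shift n (Δ F) s deg)
    where
    swap : ∀ x s → x + s + 1ℤ ≡ x + 1ℤ + s
    swap = solve-∀

  DegreeBelow-* : ∀ m n F G → DegreeBelow m F → DegreeBelow n G →
    DegreeBelow (m ℕ.+ n) (λ x → F x * G x)
  DegreeBelow-* zero n F G degF degG =
    DegreeBelow-mono {n = n} (λ x → F x * G x) z≤n (λ x → cong (_* G x) (degF x))
  DegreeBelow-* (suc m) zero F G degF degG =
    DegreeBelow-mono {n = suc m ℕ.+ 0} (λ x → F x * G x) z≤n
      (λ x → trans (cong (F x *_) (degG x)) (*-zeroʳ (F x)))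
  DegreeBelow-* (suc m) (suc n) F G degF degG =
    DegreeBelow-resp (m ℕ.+ suc n) (λ x → sym (leibniz (F (x + 1ℤ)) (F x) (G (x + 1ℤ)) (G x)))
      (DegreeBelow-+ (m ℕ.+ suc n) _ _ shiftedF*ΔG ΔF*G)
    where
    leibniz : ∀ a b c d → a * c - b * d ≡ a * (c - d) + (a - b) * d
    leibniz = solve-∀
    shiftedF*ΔG : DegreeBelow (m ℕ.+ suc n) (λ x → F (x + 1ℤ) * Δ G x)
    shiftedF*ΔG = subst (λ k → DegreeBelow k (λ x → F (x + 1ℤ) * Δ G x)) (sym (ℕ.+-suc m n))
      (DegreeBelow-* (suc m) n (λ x → F (x + 1ℤ)) (Δ G) (DegreeBelow-shift (suc m) F 1ℤ degF) degG)
    ΔF*G : DegreeBelow (m ℕ.+ suc n) (λ x → Δ F x * G x)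
    ΔF*G = DegreeBelow-* m (suc n) (Δ F) G degF degG

  DegreeBelow-affine : ∀ a b → DegreeBelow 2 (λ y → a + y * b)
  DegreeBelow-affine a b = second-difference a b
    where
    second-difference : ∀ a b y →
      ((a + (y + 1ℤ + 1ℤ) * b) - (a + (y + 1ℤ) * b)) - ((a + (y + 1ℤ) * b) - (a + y * b)) ≡ 0ℤ
    second-difference = solve-∀

  -- Not sharp: DegreeBelow-* adds the bounds, so each Horner step costs 2.
  degreeBound : Poly → ℕ
  degreeBound []       = 0
  degreeBound (_ ∷ cs) = 2 ℕ.+ degreeBound cs

  DegreeBelow-eval-affine : ∀ P a b → DegreeBelow (degreeBound P) (λ y → eval P (a + y * b))
  DegreeBelow-eval-affine []       a b y = refl
  DegreeBelow-eval-affine (c ∷ cs) a b =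
    DegreeBelow-+ (degreeBound (c ∷ cs)) (λ _ → c) (λ y → (a + y * b) * eval cs (a + y * b))
      (DegreeBelow-mono {n = degreeBound (c ∷ cs)} (λ _ → c) (s≤s z≤n) (DegreeBelow-const c))
      (DegreeBelow-* 2 (degreeBound cs) (λ y → a + y * b) (λ y → eval cs (a + y * b))
        (DegreeBelow-affine a b) (DegreeBelow-eval-affine cs a b))

  DegreeBelow-prodFin : ∀ K (G : Fin K → ℤ → ℤ) (d : Fin K → ℕ) → (∀ i → DegreeBelow (d i) (G i)) →
    DegreeBelow (suc (sumFin K d)) (λ y → prodFin K (λ i → G i y))
  DegreeBelow-prodFin zero    G d deg = DegreeBelow-const 1ℤ
  DegreeBelow-prodFin (suc K) G d deg =
    subst (λ n → DegreeBelow n (λ y → prodFin (suc K) (λ i → G i y))) (ℕ.+-suc (d fzero) _)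
      (DegreeBelow-* (d fzero) _ (G fzero) (λ y → prodFin K (λ i → G (fsuc i) y)) (deg fzero)
        (DegreeBelow-prodFin K (λ i → G (fsuc i)) (λ i → d (fsuc i)) (λ i → deg (fsuc i))))

  prodDegreeBound : ∀ K → (Fin K → Poly) → ℕ
  prodDegreeBound K P = suc (sumFin K (λ i → degreeBound (P i)))

  DegreeBelow-prodFin-eval-affine : ∀ K (P : Fin K → Poly) a b →
    DegreeBelow (prodDegreeBound K P) (λ y → prodFin K (λ i → eval (P i) (a + y * b)))
  DegreeBelow-prodFin-eval-affine K P a b =
    DegreeBelow-prodFin K (λ i y → eval (P i) (a + y * b)) (λ i → degreeBound (P i))
      (λ i → DegreeBelow-eval-affine (P i) a b)

  ∣F[1,N]⇒∣F0 : ∀ N {F d} → DegreeBelow N F → (∀ (i : Fin N) → d ∣ F (+ suc (toℕ i))) → d ∣ F 0ℤ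
  ∣F[1,N]⇒∣F0 zero    deg _ = subst (_ ∣_) (sym (deg 0ℤ)) (divides 0ℤ refl)
  ∣F[1,N]⇒∣F0 (suc N) {F} {d} deg d∣F[1,N] =
    subst (d ∣_) (a-[a-b]≡b (F 1ℤ) (F 0ℤ))
      (∣m∣n⇒∣m-n (d∣F[1,N] fzero) (∣F[1,N]⇒∣F0 N deg d∣ΔF[1,N]))
    where
    a-[a-b]≡b : ∀ a b → a - (a - b) ≡ b
    a-[a-b]≡b = solve-∀
    d∣ΔF[1,N] : ∀ (i : Fin N) → d ∣ Δ F (+ suc (toℕ i))
    d∣ΔF[1,N] i = ∣m∣n⇒∣m-n
      (subst (λ j → d ∣ F (+ suc j)) (ℕ.+-comm 1 (toℕ i)) (d∣F[1,N] (fsuc i)))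
      (subst (λ j → d ∣ F (+ suc j)) (toℕ-inject₁ i) (d∣F[1,N] (inject₁ i)))

  ∤F0⇒∃∤F[1,N] : ∀ N {F d} → DegreeBelow N F → ¬ d ∣ F 0ℤ →
    Σ (Fin N) λ i → ¬ d ∣ F (+ suc (toℕ i))
  ∤F0⇒∃∤F[1,N] N {F} {d} deg d∤F0 =
    ¬∀⟶∃¬ N _ (λ i → d ∣? F (+ suc (toℕ i))) (d∤F0 ∘ ∣F[1,N]⇒∣F0 N deg)

module Congruence where
  open import Data.Integer using (0ℤ; _+_; _*_; _-_; -_)
  open import Data.Integer.Properties using (pos-+; pos-*)
  open import Data.Integer.Divisibility.Signed
    using ( _∣_; divides; ∣-refl; ∣-trans; ∣m∣n⇒∣m+n; ∣n⇒∣m*n; ∣m⇒∣m*n; ∣m⇒∣-m; ∣m+n∣n⇒∣m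
          ; ∣ᵤ⇒∣; ∣⇒∣ᵤ)
  open import Data.Integer.Tactic.RingSolver using (solve-∀)
  open import Relation.Binary.PropositionalEquality using (cong₂; module ≡-Reasoning)

  -- A record, not a plain definition, so that x and y can be inferred from the type.
  infix 4 _≡_mod_
  record _≡_mod_ (x y : ℤ) (q : ℕ) : Set where
    constructor ≡-mod
    field q∣x-y : + q ∣ x - y

  CongruencePreserving : (ℤ → ℤ) → Set
  CongruencePreserving F = ∀ {x y q} → x ≡ y mod q → F x ≡ F y mod q

  ≡-mod-sym : ∀ {x y q} → x ≡ y mod q → y ≡ x mod q
  ≡-mod-sym {x} {y} (≡-mod q∣x-y) = ≡-mod (subst (_ ∣_) (neg-minus x y) (∣m⇒∣-m q∣x-y))
    where
    neg-minus : ∀ x y → - (x - y) ≡ y - x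
    neg-minus = solve-∀

  +-≡-mod : ∀ c {x y q} → x ≡ y mod q → c + x ≡ c + y mod q
  +-≡-mod c {x} {y} (≡-mod q∣x-y) = ≡-mod (subst (_ ∣_) (sym (cancel c x y)) q∣x-y)
    where
    cancel : ∀ c x y → (c + x) - (c + y) ≡ x - y
    cancel = solve-∀

  *-≡-mod : ∀ {a b c d q} → a ≡ b mod q → c ≡ d mod q → a * c ≡ b * d mod q
  *-≡-mod {a} {b} {c} {d} (≡-mod q∣a-b) (≡-mod q∣c-d) =
    ≡-mod (subst (_ ∣_) (sym (split a b c d)) (∣m∣n⇒∣m+n (∣n⇒∣m*n a q∣c-d) (∣m⇒∣m*n d q∣a-b)))
    where
    split : ∀ a b c d → a * c - b * d ≡ a * (c - d) + (a - b) * d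
    split = solve-∀

  eval-≡-mod : ∀ P → CongruencePreserving (eval P)
  eval-≡-mod []       x≡y = ≡-mod (divides 0ℤ refl)
  eval-≡-mod (c ∷ cs) x≡y = +-≡-mod c (*-≡-mod x≡y (eval-≡-mod cs x≡y))

  prodFin-≡-mod : ∀ K {g h q} → (∀ i → g i ≡ h i mod q) → prodFin K g ≡ prodFin K h mod q
  prodFin-≡-mod zero    g≡h = ≡-mod (divides 0ℤ refl)
  prodFin-≡-mod (suc K) g≡h = *-≡-mod (g≡h fzero) (prodFin-≡-mod K (λ i → g≡h (fsuc i)))

  Wv-≡-mod : ∀ K W v → CongruencePreserving (Wv K W v)
  Wv-≡-mod K W v x≡y = prodFin-≡-mod K (λ i → eval-≡-mod (W i v) x≡y)

  +[x+k*q]≡+x : ∀ x k q → + (x ℕ.+ k ℕ.* q) ≡ + x mod q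
  +[x+k*q]≡+x x k q = ≡-mod (subst (_ ∣_) (sym difference) (∣n⇒∣m*n (+ k) ∣-refl))
    where
    open ≡-Reasoning
    x+y-x≡y : ∀ x y → x + y - x ≡ y
    x+y-x≡y = solve-∀
    difference : + (x ℕ.+ k ℕ.* q) - + x ≡ + k * + q
    difference = begin
      + (x ℕ.+ k ℕ.* q) - + x   ≡⟨ cong (_- + x) (pos-+ x (k ℕ.* q)) ⟩
      + x + + (k ℕ.* q) - + x  ≡⟨ x+y-x≡y (+ x) (+ (k ℕ.* q)) ⟩
      + (k ℕ.* q)              ≡⟨ pos-* k q ⟩
      + k * + q               ∎

  coprime-resp-≡-mod : ∀ {x y q} → x ≡ y mod q → Coprime ∣ x ∣ q → Coprime ∣ y ∣ q
  coprime-resp-≡-mod {x} {y} (≡-mod q∣x-y) x⊥q (i∣y , i∣q) = x⊥q (∣⇒∣ᵤ i∣x , i∣q)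
    where
    i∣x : + _ ∣ x
    i∣x = ∣m+n∣n⇒∣m (∣-trans (∣ᵤ⇒∣ i∣q) q∣x-y) (∣m⇒∣-m (∣ᵤ⇒∣ i∣y))

  prodFin-cong : ∀ K {g h} → (∀ i → g i ≡ h i) → prodFin K g ≡ prodFin K h
  prodFin-cong zero    g≡h = refl
  prodFin-cong (suc K) g≡h = cong₂ _*_ (g≡h fzero) (prodFin-cong K (λ i → g≡h (fsuc i)))

  prodFin-distrib-* : ∀ K g h → prodFin K (λ i → g i * h i) ≡ prodFin K g * prodFin K h
  prodFin-distrib-* zero    g h = refl
  prodFin-distrib-* (suc K) g h = begin
      g fzero * h fzero * prodFin K (λ i → g (fsuc i) * h (fsuc i))
    ≡⟨ cong (g fzero * h fzero *_) (prodFin-distrib-* K (λ i → g (fsuc i)) (λ i → h (fsuc i))) ⟩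
      g fzero * h fzero * (prodFin K (λ i → g (fsuc i)) * prodFin K (λ i → h (fsuc i)))
    ≡⟨ interchange (g fzero) (h fzero) _ _ ⟩
      g fzero * prodFin K (λ i → g (fsuc i)) * (h fzero * prodFin K (λ i → h (fsuc i)))
    ∎
    where
    open ≡-Reasoning
    interchange : ∀ a b c d → a * b * (c * d) ≡ a * c * (b * d)
    interchange = solve-∀

module PrimeFactors where
  open import Data.Nat using (_*_; _!; NonZero; ≢-nonZero; ≢-nonZero⁻¹)
  open import Data.Nat.Properties
    using (≤-pred; ≤∧≢⇒<; ≰⇒>; n≤0⇒n≡0; *-identityˡ; *-assoc)
  open import Data.Nat.Divisibility
  open import Data.Nat.Coprimality using (Coprime)
  open import Data.Nat.Primality
    using (Prime; prime?; prime[2]; ¬prime[1]; euclidsLemma; prime⇒irreducible; prime⇒nonZero; prime⇒nonTrivial)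
  open import Data.Nat.Primality.Factorisation using (factorise)
  open import Data.Nat.Induction using (<-wellFounded)
  open import Data.Nat.Tactic.RingSolver using (solve-∀)
  open import Induction.WellFounded using (Acc; acc)
  open import Data.List.Relation.Unary.All using (_∷_)
  open import Data.Sum using (inj₁; inj₂; [_,_])
  open import Relation.Nullary using (¬_; yes; no; contradiction)
  open import Relation.Nullary.Decidable using (_×-dec_)
  open import Relation.Binary.PropositionalEquality using (refl; sym; trans; cong; subst; subst₂)

  ∃-prime-factor : ∀ {n} → 1 < n → Σ ℕ λ p → Prime p × p ∣ n
  ∃-prime-factor {1} (s≤s ())
  ∃-prime-factor {n@(suc (suc _))} _ with factorise n
  ... | record { factors = p ∷ _ ; isFactorisation = n≡∏ ; factorsPrime = p-prime ∷ _ } =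
    p , p-prime , subst (p ∣_) (sym n≡∏) (m∣m*n _)

  ¬common-prime⇒coprime : ∀ {a b} → (∀ {p} → Prime p → p ∣ a → p ∤ b) → Coprime a b
  ¬common-prime⇒coprime h {zero} (0∣a , 0∣b) =
    contradiction (∣-trans (2 ∣0) 0∣b) (h prime[2] (∣-trans (2 ∣0) 0∣a))
  ¬common-prime⇒coprime h {1} _ = refl
  ¬common-prime⇒coprime h {suc (suc i)} (i∣a , i∣b) =
    let p , p-prime , p∣i = ∃-prime-factor {suc (suc i)} (s≤s (s≤s z≤n))
    in contradiction (∣-trans p∣i i∣b) (h p-prime (∣-trans p∣i i∣a))

  coprime-∣ʳ : ∀ {a b c} → Coprime a b → c ∣ b → Coprime a c
  coprime-∣ʳ a⊥b c∣b (i∣a , i∣c) = a⊥b (i∣a , ∣-trans i∣c c∣b)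

  coprime∧∣⇒∤ : ∀ {a b p} → Coprime a b → Prime p → p ∣ a → p ∤ b
  coprime∧∣⇒∤ a⊥b p-prime p∣a p∣b = ¬prime[1] (subst Prime (a⊥b (p∣a , p∣b)) p-prime)

  prime∤⇒coprime : ∀ {p n} → Prime p → p ∤ n → Coprime p n
  prime∤⇒coprime p-prime p∤n (i∣p , i∣n) with prime⇒irreducible p-prime i∣p
  ... | inj₁ i≡1 = i≡1
  ... | inj₂ refl = contradiction i∣n p∤n

  prime∣p^a⇒≡p : ∀ {l p} a → Prime l → Prime p → l ∣ p ^ a → l ≡ p
  prime∣p^a⇒≡p zero l-prime _ l∣1 = contradiction (subst Prime (∣1⇒≡1 l∣1) l-prime) ¬prime[1]
  prime∣p^a⇒≡p {l} {p} (suc a) l-prime p-prime l∣p^[1+a] with euclidsLemma p (p ^ a) l-prime l∣p^[1+a]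
  ... | inj₂ l∣p^a = prime∣p^a⇒≡p a l-prime p-prime l∣p^a
  ... | inj₁ l∣p with prime⇒irreducible p-prime l∣p
  ...   | inj₁ l≡1 = contradiction (subst Prime l≡1 l-prime) ¬prime[1]
  ...   | inj₂ l≡p = l≡p

  coprime-p^b* : ∀ {x p q} b → Prime p → p ∤ x → Coprime x q → Coprime x (p ^ b * q)
  coprime-p^b* {x} {p} {q} b p-prime p∤x x⊥q = ¬common-prime⇒coprime λ l-prime l∣x l∣p^b*q →
    [ (λ l∣p^b → p∤x (subst (_∣ x) (prime∣p^a⇒≡p b l-prime p-prime l∣p^b) l∣x))
    , coprime∧∣⇒∤ x⊥q l-prime l∣x
    ] (euclidsLemma (p ^ b) q l-prime l∣p^b*q)

  split-prime-power : ∀ {p} → Prime p → ∀ x .{{_ : NonZero x}} →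
    Σ ℕ λ a → Σ ℕ λ y → x ≡ p ^ a * y × p ∤ y
  split-prime-power {p} p-prime x = go x (<-wellFounded x)
    where
    instance _ = prime⇒nonTrivial p-prime
    go : ∀ x .{{_ : NonZero x}} → Acc _<_ x → Σ ℕ λ a → Σ ℕ λ y → x ≡ p ^ a * y × p ∤ y
    go x (acc smaller) with p ∣? x
    ... | no  p∤x = 0 , x , sym (*-identityˡ x) , p∤x
    ... | yes p∣x =
      let instance _ = quotient≢0 p∣x
          a , y , x/p≡p^a*y , p∤y = go (quotient p∣x) (smaller (quotient-< p∣x))
      in suc a , y , trans (m∣n⇒n≡m*quotient p∣x) (trans (cong (p *_) x/p≡p^a*y) (sym (*-assoc p (p ^ a) y))) ,
         p∤y

  ∤⇒nonZero : ∀ {p y} → p ∤ y → NonZero y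
  ∤⇒nonZero {p} p∤y = ≢-nonZero λ { refl → p∤y (p ∣0) }

  ^-monoʳ-∣ : ∀ p {a b} → a ≤ b → p ^ a ∣ p ^ b
  ^-monoʳ-∣ p {b = b} z≤n     = 1∣ (p ^ b)
  ^-monoʳ-∣ p        (s≤s a≤b) = *-monoʳ-∣ p (^-monoʳ-∣ p a≤b)

  ^-distribʳ-* : ∀ a b n → (a * b) ^ n ≡ a ^ n * b ^ n
  ^-distribʳ-* a b zero    = refl
  ^-distribʳ-* a b (suc n) = trans (cong (a * b *_) (^-distribʳ-* a b n)) (interchange a b (a ^ n) (b ^ n))
    where
    interchange : ∀ a b c d → a * b * (c * d) ≡ a * c * (b * d)
    interchange = solve-∀

  kFree⇒exponent< : ∀ {k B p a y} → KFree k B → Prime p → B ≡ p ^ a * y → a < k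
  kFree⇒exponent< {p = p} {a} {y} B-kFree p-prime B≡p^a*y =
    ≰⇒> λ k≤a → B-kFree p p-prime
      (∣-trans (^-monoʳ-∣ p k≤a) (subst (p ^ a ∣_) (sym B≡p^a*y) (m∣m*n y)))

  Smooth : ℕ → ℕ → Set
  Smooth N B = ∀ {p} → Prime p → p ∣ B → p ≤ N

  smooth-pred : ∀ {N B} → Smooth (suc N) B → ¬ (Prime (suc N) × suc N ∣ B) → Smooth N B
  smooth-pred smooth ¬P∣B p-prime p∣B =
    ≤-pred (≤∧≢⇒< (smooth p-prime p∣B) λ { refl → ¬P∣B (p-prime , p∣B) })

  smooth∧kFree⇒∣[N!]^m : ∀ m N {B} .{{_ : NonZero B}} → Smooth N B → KFree (suc m) B → B ∣ (N !) ^ m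
  smooth∧kFree⇒∣[N!]^m m zero {1} _ _ = 1∣ _
  smooth∧kFree⇒∣[N!]^m m zero {B@(suc (suc _))} smooth _ =
    let p , p-prime , p∣B = ∃-prime-factor {B} (s≤s (s≤s z≤n))
    in contradiction (n≤0⇒n≡0 (smooth p-prime p∣B)) (≢-nonZero⁻¹ p {{prime⇒nonZero p-prime}})
  smooth∧kFree⇒∣[N!]^m m (suc M) {B} smooth B-kFree with prime? (suc M) ×-dec (suc M ∣? B)
  ... | no ¬P∣B = subst (B ∣_) (sym (^-distribʳ-* (suc M) (M !) m))
    (∣n⇒∣m*n (suc M ^ m) (smooth∧kFree⇒∣[N!]^m m M (smooth-pred smooth ¬P∣B) B-kFree))
  ... | yes (P-prime , _) with split-prime-power P-prime B
  ...   | a , y , B≡P^a*y , P∤y =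
    subst₂ _∣_ (sym B≡P^a*y) (sym (^-distribʳ-* (suc M) (M !) m))
      (*-pres-∣ (^-monoʳ-∣ (suc M) (≤-pred (kFree⇒exponent< {suc m} {a = a} {y} B-kFree P-prime B≡P^a*y)))
                (smooth∧kFree⇒∣[N!]^m m M {{∤⇒nonZero P∤y}} y-smooth y-kFree))
    where
    y∣B : y ∣ B
    y∣B = subst (y ∣_) (sym B≡P^a*y) (n∣m*n (suc M ^ a))
    y-smooth : Smooth M y
    y-smooth = smooth-pred (λ l-prime l∣y → smooth l-prime (∣-trans l∣y y∣B)) λ (_ , P∣y) → P∤y P∣y
    y-kFree : KFree (suc m) y
    y-kFree p p-prime p^k∣y = B-kFree p p-prime (∣-trans p^k∣y y∣B)

open FiniteDifference
open Congruence
open PrimeFactors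

open import Data.Nat using (_+_; _*_; _!; NonZero; >-nonZero; >-nonZero⁻¹)
open import Data.Nat.Properties
  using (≤-trans; <⇒≤; <⇒≱; ≮⇒≥; *-identityˡ; m^n>0; m^n≢0; _!≢0; m*n≢0⇒n≢0)
open import Data.Nat.Divisibility using (_∣_; _∤_; _∣?_; ∣-refl; ∣⇒≤; ∣m⇒∣m*n; ∣m+n∣m⇒∣n; n∣m*n)
open import Data.Nat.DivMod using (_%_; _/_; m≡m%n+[m/n]*n; m%n<n)
open import Data.Nat.Coprimality using () renaming (sym to coprime-sym)
open import Data.Nat.Primality using (euclidsLemma; prime⇒nonZero)
open import Data.Nat.Tactic.RingSolver using (solve-∀)
import Data.Integer as ℤ
open import Data.Integer using (0ℤ)
open import Data.Integer.Properties using (pos-+; pos-*; abs-*; +-identityʳ)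
open import Data.Integer.Divisibility.Signed using (∣ᵤ⇒∣; ∣⇒∣ᵤ) renaming (_∣_ to _∣ℤ_)
open import Data.Fin using (fromℕ<)
open import Data.Fin.Properties using (toℕ-fromℕ<; toℕ<n)
open import Data.Product using (proj₂)
open import Data.Sum using ([_,_])
open import Relation.Nullary using (¬_; yes; no; contradiction)

reduce-mod : ∀ F q .{{_ : NonZero q}} → CongruencePreserving F → ∀ u →
  Coprime u q → Coprime ∣ F (+ u) ∣ q → Σ ℕ λ r → r < q × Coprime r q × Coprime ∣ F (+ r) ∣ q
reduce-mod F q F-mod u u⊥q Fu⊥q =
  u % q , m%n<n u q , coprime-resp-≡-mod u≡r u⊥q , coprime-resp-≡-mod (F-mod u≡r) Fu⊥q
  where
  u≡r : + u ≡ + (u % q) mod q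
  u≡r = subst (λ t → + t ≡ + (u % q) mod q) (sym (m≡m%n+[m/n]*n u q)) (+[x+k*q]≡+x (u % q) (u / q) q)

coprime-value-at-unit : ∀ N F q p .{{_ : NonZero q}} → Prime p → N < p →
  (∀ x c → DegreeBelow N (λ y → F (x ℤ.+ y ℤ.* c))) → CongruencePreserving F →
  Coprime ∣ F (+ p) ∣ q → Σ ℕ λ u → u < q × Coprime u q × Coprime ∣ F (+ u) ∣ q
coprime-value-at-unit N F q p p-prime N<p deg F-mod Fp⊥q with p ∣? q | split-prime-power p-prime q
... | no  p∤q | _ = reduce-mod F q F-mod p (prime∤⇒coprime p-prime p∤q) Fp⊥q
... | yes p∣q | b , q' , q≡p^b*q' , p∤q' with ∤F0⇒∃∤F[1,N] N (deg (+ p) (+ q')) p∤F[p+0q']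
  where
  p∤F[p+0q'] : ¬ + p ∣ℤ F (+ p ℤ.+ 0ℤ ℤ.* + q')
  p∤F[p+0q'] p∣F[p+0q'] =
    coprime∧∣⇒∤ Fp⊥q p-prime (∣⇒∣ᵤ (subst (λ x → + p ∣ℤ F x) (+-identityʳ (+ p)) p∣F[p+0q'])) p∣q
...   | i , p∤F[p+jq'] = reduce-mod F q F-mod u (coprime-q u⊥q' p∤u) (coprime-q Fu⊥q' p∤Fu)
  where
  coprime-q : ∀ {x} → Coprime x q' → p ∤ x → Coprime x q
  coprime-q x⊥q' p∤x = subst (Coprime _) (sym q≡p^b*q') (coprime-p^b* b p-prime p∤x x⊥q')
  j = suc (toℕ i)
  u = p + j * q'
  u≡p : + u ≡ + p mod q'
  u≡p = +[x+k*q]≡+x p j q'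
  p∤j : p ∤ j
  p∤j p∣j = <⇒≱ N<p (≤-trans (∣⇒≤ p∣j) (toℕ<n i))
  p∤u : p ∤ u
  p∤u p∣u = [ p∤j , p∤q' ] (euclidsLemma j q' p-prime (∣m+n∣m⇒∣n p∣u ∣-refl))
  u⊥q' : Coprime u q'
  u⊥q' = coprime-resp-≡-mod (≡-mod-sym u≡p) (prime∤⇒coprime p-prime p∤q')
  +u≡+p+jq' : + u ≡ + p ℤ.+ + j ℤ.* + q'
  +u≡+p+jq' = trans (pos-+ p (j * q')) (cong (ℤ._+_ (+ p)) (pos-* j q'))
  p∤Fu : p ∤ ∣ F (+ u) ∣
  p∤Fu = p∤F[p+jq'] ∘ subst (λ x → + p ∣ℤ F x) +u≡+p+jq' ∘ ∣ᵤ⇒∣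
  q'∣q : q' ∣ q
  q'∣q = subst (q' ∣_) (sym q≡p^b*q') (n∣m*n (p ^ b))
  Fu⊥q' : Coprime ∣ F (+ u) ∣ q'
  Fu⊥q' = coprime-resp-≡-mod (F-mod (≡-mod-sym u≡p)) (coprime-∣ʳ Fp⊥q q'∣q)

kFreePart-nonZero : ∀ {k n B} → 0 < n → IsKFreePart k n B → NonZero B
kFreePart-nonZero 0<n (A , n≡A*B , _) = m*n≢0⇒n≢0 A {{>-nonZero (subst (0 <_) n≡A*B 0<n)}}

kFreePart-exact-power : ∀ {k n B p} → IsKFreePart k n B → .{{_ : NonZero B}} → Prime p → p ∣ B →
  Σ ℕ λ a → Σ ℕ λ n' → 0 < a × a < k × n ≡ p ^ a * n' × p ∤ n'
kFreePart-exact-power {k} {n} {B} {p} (A , n≡A*B , A⊥B , _ , B-kFree) p-prime p∣B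
  with split-prime-power p-prime B
... | zero  , y , B≡1*y , p∤y = contradiction (subst (p ∣_) (trans B≡1*y (*-identityˡ y)) p∣B) p∤y
... | suc e , y , B≡p^a*y , p∤y =
  suc e , A * y , s≤s z≤n , kFree⇒exponent< {k} {a = suc e} {y} B-kFree p-prime B≡p^a*y ,
  n≡p^a*[A*y] , p∤A*y
  where
  left-comm : ∀ x y z → x * (y * z) ≡ y * (x * z)
  left-comm = solve-∀
  n≡p^a*[A*y] : n ≡ p ^ suc e * (A * y)
  n≡p^a*[A*y] = trans n≡A*B (trans (cong (A *_) B≡p^a*y) (left-comm A (p ^ suc e) y))
  p∤A*y : p ∤ A * y
  p∤A*y p∣A*y = [ coprime∧∣⇒∤ (coprime-sym A⊥B) p-prime p∣B , p∤y ] (euclidsLemma A y p-prime p∣A*y)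

coprime-Wv-at-prime : ∀ {K V} {W : Fin K → ℕ → Poly} {f : Fin K → ℕ → ℤ} →
  (∀ i → Multiplicative (f i)) →
  (∀ i p v → Prime p → 1 ≤ v → v ≤ V → f i (p ^ v) ≡ eval (W i v) (+ p)) →
  ∀ {n p a n' q} → Prime p → 0 < a → a ≤ V → n ≡ p ^ a * n' → p ∤ n' →
  Coprime ∣ prodFin K (λ i → f i n) ∣ q → Coprime ∣ Wv K W a (+ p) ∣ q
coprime-Wv-at-prime {K} {W = W} {f} f-mult f-pow {n} {p} {a} {n'}
                    p-prime 0<a a≤V n≡p^a*n' p∤n' fn⊥q (i∣Wp , i∣q) =
  fn⊥q (subst (_ ∣_) (sym ∣fn∣≡∣Wp∣*∣fn'∣) (∣m⇒∣m*n _ i∣Wp) , i∣q)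
  where
  instance _ = prime⇒nonZero p-prime
  p^a⊥n' : Coprime (p ^ a) n'
  p^a⊥n' = ¬common-prime⇒coprime λ l-prime l∣p^a →
    subst (_∤ n') (sym (prime∣p^a⇒≡p a l-prime p-prime l∣p^a)) p∤n'
  f[n]≡W[p]*f[n'] : ∀ i → f i n ≡ eval (W i a) (+ p) ℤ.* f i n'
  f[n]≡W[p]*f[n'] i = trans (cong (f i) n≡p^a*n')
    (trans (proj₂ (f-mult i) (p ^ a) n' (m^n>0 p a) (>-nonZero⁻¹ n' {{∤⇒nonZero p∤n'}}) p^a⊥n')
           (cong (ℤ._* f i n') (f-pow i p a p-prime 0<a a≤V)))
  ∣fn∣≡∣Wp∣*∣fn'∣ : ∣ prodFin K (λ i → f i n) ∣ ≡ ∣ Wv K W a (+ p) ∣ * ∣ prodFin K (λ i → f i n') ∣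
  ∣fn∣≡∣Wp∣*∣fn'∣ = trans
    (cong ∣_∣ (trans (prodFin-cong K f[n]≡W[p]*f[n'])
                     (prodFin-distrib-* K (λ i → eval (W i a) (+ p)) (λ i → f i n'))))
    (abs-* (Wv K W a (+ p)) (prodFin K (λ i → f i n')))

totalDegreeBound : ∀ K m → (Fin K → Fin (suc m) → Poly) → ℕ
totalDegreeBound K m W = sumFin (suc m) (λ j → prodDegreeBound K (λ i → W i j))

DegreeBelow-Wv : ∀ {K m} (W : Fin K → Fin (suc m) → Poly) (W' : Fin K → ℕ → Poly) →
  (∀ i j → W' i (suc (toℕ j)) ≡ W i j) → ∀ {a} → 0 < a → a ≤ suc m → ∀ x c →
  DegreeBelow (totalDegreeBound K m W) (λ y → Wv K W' a (x ℤ.+ y ℤ.* c))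
DegreeBelow-Wv {K} {m} W W' W'≡W {suc e} _ e<1+m x c =
  DegreeBelow-mono {n = totalDegreeBound K m W} (λ y → Wv K W' (suc e) (x ℤ.+ y ℤ.* c))
    (≤-sumFin (suc m) (λ j → prodDegreeBound K (λ i → W i j)) j)
    (DegreeBelow-resp (prodDegreeBound K (λ i → W i j))
      (λ y → prodFin-cong K (λ i → cong (λ P → eval P (x ℤ.+ y ℤ.* c)) (W≡W' i)))
      (DegreeBelow-prodFin-eval-affine K (λ i → W i j) x c))
  where
  j = fromℕ< e<1+m
  W≡W' : ∀ i → W i j ≡ W' i (suc e)
  W≡W' i = trans (sym (W'≡W i j)) (cong (λ t → W' i (suc t)) (toℕ-fromℕ< e<1+m))

kFreePart-smooth : ∀ {K m V q n B} (W : Fin K → Fin (suc m) → Poly) (W' : Fin K → ℕ → Poly)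
  {f : Fin K → ℕ → ℤ} → (∀ i j → W' i (suc (toℕ j)) ≡ W i j) → suc m ≤ V →
  (∀ i → Multiplicative (f i)) →
  (∀ i p v → Prime p → 1 ≤ v → v ≤ V → f i (p ^ v) ≡ eval (W' i v) (+ p)) →
  .{{_ : NonZero q}} → Admissible K W' (suc m) q → Coprime ∣ prodFin K (λ i → f i n) ∣ q →
  IsKFreePart (suc m) n B → .{{_ : NonZero B}} → Smooth (totalDegreeBound K m W) B
kFreePart-smooth {K} {m} {q = q} W W' W'≡W k≤V f-mult f-pow adm fn⊥q B-part {p} p-prime p∣B =
  ≮⇒≥ λ N<p →
    let a , n' , 0<a , a<k , n≡p^a*n' , p∤n' = kFreePart-exact-power {suc m} B-part p-prime p∣B
    in proj₂ adm a 0<a a<k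
         (coprime-value-at-unit _ (Wv K W' a) q p p-prime N<p
           (DegreeBelow-Wv W W' W'≡W 0<a (<⇒≤ a<k)) (Wv-≡-mod K W' a)
           (coprime-Wv-at-prime {W = W'} f-mult f-pow p-prime 0<a (≤-trans (<⇒≤ a<k) k≤V)
             n≡p^a*n' p∤n' fn⊥q))

lemma3p3 : (K m : ℕ) → 1 ≤ K →
    (W : Fin K → Fin (suc m) → Poly) →
    (∀ i → Nonconstant (W i (fromℕ m))) →
    MultIndependent K (λ i → W i (fromℕ m)) →
    Σ ℕ λ C →
      (V : ℕ) → suc m ≤ V →
      (W' : Fin K → ℕ → Poly) →
      (∀ i j → W' i (suc (toℕ j)) ≡ W i j) →
      (f : Fin K → ℕ → ℤ) →
      (∀ i → Multiplicative (f i)) →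
      (∀ i p v → Prime p → 1 ≤ v → v ≤ V → f i (p ^ v) ≡ eval (W' i v) (+ p)) →
      (q : ℕ) → 1 ≤ q → Admissible K W' (suc m) q →
      (n : ℕ) → 1 ≤ n → Coprime ∣ prodFin K (λ i → f i n) ∣ q →
      (B : ℕ) → IsKFreePart (suc m) n B → B ≤ C
lemma3p3 K m _ W _ _ = (N !) ^ m ,
  λ { V k≤V W' W'≡W f f-mult f-pow q 0<q adm n 0<n fn⊥q B B-part@(_ , _ , _ , _ , B-kFree) →
      let instance _ = kFreePart-nonZero {suc m} 0<n B-part
          instance _ = >-nonZero 0<q
      in ∣⇒≤ {{m^n≢0 (N !) m {{N !≢0}}}}
           (smooth∧kFree⇒∣[N!]^m m N (kFreePart-smooth W W' W'≡W k≤V f-mult f-pow adm fn⊥q B-part) B-kFree) }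
  where
  N = totalDegreeBound K m W
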